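{- The sequent calculus $\mathtt{SkMBiCT}$ is cut-free, i.e. the rule: from $U \vdash A$ and $T[A] \vdash C$ infer $T[U] \vdash C$ (for any tree $U$, context $T[\cdot]$, formulae $A, C$) is admissible.
   Context: Formulae are generated by $A,B ::= X \mid \mathsf{I} \mid A \otimes^{\mathsf{L}} B \mid A \multimap^{\mathsf{L}} B \mid A \otimes^{\mathsf{R}} B \mid A \multimap^{\mathsf{R}} B$, with $X$ ranging over a set of atoms. Trees are generated by $T ::= A \mid { - } \mid (T,T) \mid (T;T)$, where $A$ is a formula and ${ - }$ the empty tree (two binary tree constructors, comma and semicolon). Contexts are trees with exactly one hole $[\cdot]$ in place of a subtree, and $T[U]$ denotes substitution of the tree $U$ for the hole. Sequents have the form $T \vdash A$. Derivations of $\mathtt{SkMBiCT}$ are generated by: (ax) $A \vdash A$; (IR) ${ - } \vdash \mathsf{I}$; (IL) from $T[{ - }] \vdash C$ infer $T[\mathsf{I}]\vdash C$; ($\otimes^{\mathsf{L}}$L) from $T[A,B] \vdash C$ infer $T[A\otimes^{\mathsf{L}} B] \vdash C$; ($\otimes^{\mathsf{L}}$R) from $T\vdash A$ and $U \vdash B$ infer $T,U \vdash A \otimes^{\mathsf{L}} B$; ($\otimes^{\mathsf{R}}$L) from $T[A;B] \vdash C$ infer $T[A\otimes^{\mathsf{R}} B] \vdash C$; ($\otimes^{\mathsf{R}}$R) from $T\vdash A$ and $U \vdash B$ infer $T;U \vdash A \otimes^{\mathsf{R}} B$; ($\multimap^{\mathsf{L}}$L) from $U \vdash A$ and $T[B]\vdash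 C$ infer $T[A\multimap^{\mathsf{L}} B, U] \vdash C$; ($\multimap^{\mathsf{L}}$R) from $T, A \vdash B$ infer $T \vdash A \multimap^{\mathsf{L}} B$; ($\multimap^{\mathsf{R}}$L) from $U \vdash A$ and $T[B]\vdash C$ infer $T[A\multimap^{\mathsf{R}} B ; U] \vdash C$; ($\multimap^{\mathsf{R}}$R) from $T ; A \vdash B$ infer $T \vdash A \multimap^{\mathsf{R}} B$; (assoc$^{\mathsf{L}}$) from $T[U_0,(U_1,U_2)] \vdash C$ infer $T[(U_0,U_1),U_2]\vdash C$; ($\otimes$comm, invertible, i.e. in both directions) $T[U_0,U_1] \vdash C$ iff $T[U_1;U_0] \vdash C$; (assoc$^{\mathsf{R}}$) from $T[(U_0;U_1);U_2] \vdash C$ infer $T[U_0;(U_1;U_2)]\vdash C$; (unitL$^{\mathsf{L}}$) from $T[U]\vdash C$ infer $T[{ - },U] \vdash C$; (unitR$^{\mathsf{L}}$) from $T[U,{ - }]\vdash C$ infer $T[U]\vdash C$; (unitL$^{\mathsf{R}}$) from $T[U]\vdash C$ infer $T[U;{ - }] \vdash C$; (unitR$^{\mathsf{R}}$) from $T[{ - };U]\vdash C$ infer $T[U]\vdash C$. -}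

module Defs where

module SkMBiCT (At : Set) where

  data Fma : Set where
    at   : At → Fma
    I    : Fma
    _⊗L_ : Fma → Fma → Fma
    _⊸L_ : Fma → Fma → Fma
    _⊗R_ : Fma → Fma → Fma
    _⊸R_ : Fma → Fma → Fma

  data Tree : Set where
    η    : Fma → Tree
    ─    : Tree
    _,,_ : Tree → Tree → Tree
    _︔_  : Tree → Tree → Tree

  data Ctx : Set where
    ∙    : Ctx
    _,ₗ_ : Ctx → Tree → Ctx
    _,ᵣ_ : Tree → Ctx → Ctx
    _︔ₗ_ : Ctx → Tree → Ctx
    _︔ᵣ_ : Tree → Ctx → Ctx

  _[_] : Ctx → Tree → Tree
  ∙ [ U ] = U
  (T ,ₗ V) [ U ] = (T [ U ]) ,, V
  (V ,ᵣ T) [ U ] = V ,, (T [ U ])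
  (T ︔ₗ V) [ U ] = (T [ U ]) ︔ V
  (V ︔ᵣ T) [ U ] = V ︔ (T [ U ])

  infix 3 _⊢_

  data _⊢_ : Tree → Fma → Set where
    ax   : ∀ {A} → η A ⊢ A
    IR   : ─ ⊢ I
    IL   : ∀ {T C} → T [ ─ ] ⊢ C → T [ η I ] ⊢ C
    ⊗LL  : ∀ {T A B C} → T [ η A ,, η B ] ⊢ C → T [ η (A ⊗L B) ] ⊢ C
    ⊗LR  : ∀ {T U A B} → T ⊢ A → U ⊢ B → T ,, U ⊢ A ⊗L B
    ⊗RL  : ∀ {T A B C} → T [ η A ︔ η B ] ⊢ C → T [ η (A ⊗R B) ] ⊢ C
    ⊗RR  : ∀ {T U A B} → T ⊢ A → U ⊢ B → T ︔ U ⊢ A ⊗R B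
    ⊸LL  : ∀ {T U A B C} → U ⊢ A → T [ η B ] ⊢ C → T [ η (A ⊸L B) ,, U ] ⊢ C
    ⊸LR  : ∀ {T A B} → T ,, η A ⊢ B → T ⊢ A ⊸L B
    ⊸RL  : ∀ {T U A B C} → U ⊢ A → T [ η B ] ⊢ C → T [ η (A ⊸R B) ︔ U ] ⊢ C
    ⊸RR  : ∀ {T A B} → T ︔ η A ⊢ B → T ⊢ A ⊸R B
    assocL : ∀ {T U₀ U₁ U₂ C} → T [ U₀ ,, (U₁ ,, U₂) ] ⊢ C → T [ (U₀ ,, U₁) ,, U₂ ] ⊢ C
    comm   : ∀ {T U₀ U₁ C} → T [ U₀ ,, U₁ ] ⊢ C → T [ U₁ ︔ U₀ ] ⊢ C
    comm⁻¹ : ∀ {T U₀ U₁ C} → T [ U₁ ︔ U₀ ] ⊢ C → T [ U₀ ,, U₁ ] ⊢ C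
    assocR : ∀ {T U₀ U₁ U₂ C} → T [ (U₀ ︔ U₁) ︔ U₂ ] ⊢ C → T [ U₀ ︔ (U₁ ︔ U₂) ] ⊢ C
    unitLL : ∀ {T U C} → T [ U ] ⊢ C → T [ ─ ,, U ] ⊢ C
    unitRL : ∀ {T U C} → T [ U ,, ─ ] ⊢ C → T [ U ] ⊢ C
    unitLR : ∀ {T U C} → T [ U ] ⊢ C → T [ U ︔ ─ ] ⊢ C
    unitRR : ∀ {T U C} → T [ ─ ︔ U ] ⊢ C → T [ U ] ⊢ C

{-# OPTIONS --safe #-}
module Submission where

-- Induction on the cut formula A and, lexicographically, on the left premise U ⊢ A. Every
-- rule other than the axioms and the right rules rewrites a subtree X′ of the antecedent to X
-- in an arbitrary context (X′ ↝ X), so when the left premise ends in such a rule the cut moves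
-- into its premise. When it ends in a right rule, the cut is pushed up the right premise: the
-- occurrence of A is either apart from the subtree the last rule rewrites, and the cut commutes
-- with the rule, or lies inside it and is traced through the rule, until A is principal on
-- both sides and the cut reduces to cuts on its immediate subformulae.

open import Defs
open import Data.Unit using (⊤)
open import Data.Product using (_×_; _,_; proj₁; proj₂)
open import Relation.Binary.PropositionalEquality using (_≡_; _≢_; refl; sym; cong)

module CutAdmissibility (At : Set) where
  open SkMBiCT At

  private variable
    A B A₁ B₁ C Y : Fma
    U U₀ U₁ U₂ V W X X′ : Tree
    T T′ : Ctx

  cast : V ≡ W → V ⊢ C → W ⊢ C
  cast refl d = d

  ,,-injective : U₀ ,, U₁ ≡ V ,, W → U₀ ≡ V × U₁ ≡ W
  ,,-injective refl = refl , refl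

  ︔-injective : U₀ ︔ U₁ ≡ V ︔ W → U₀ ≡ V × U₁ ≡ W
  ︔-injective refl = refl , refl

  ─-has-no-hole : ∀ K → ─ ≢ K [ η A ]
  ─-has-no-hole ∙ ()

  _∘ᶜ_ : Ctx → Ctx → Ctx
  ∙ ∘ᶜ K = K
  (T ,ₗ V) ∘ᶜ K = (T ∘ᶜ K) ,ₗ V
  (V ,ᵣ T) ∘ᶜ K = V ,ᵣ (T ∘ᶜ K)
  (T ︔ₗ V) ∘ᶜ K = (T ∘ᶜ K) ︔ₗ V
  (V ︔ᵣ T) ∘ᶜ K = V ︔ᵣ (T ∘ᶜ K)

  []-∘ᶜ : ∀ T K Z → (T ∘ᶜ K) [ Z ] ≡ T [ K [ Z ] ]
  []-∘ᶜ ∙ K Z = refl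
  []-∘ᶜ (T ,ₗ V) K Z = cong (_,, V) ([]-∘ᶜ T K Z)
  []-∘ᶜ (V ,ᵣ T) K Z = cong (V ,,_) ([]-∘ᶜ T K Z)
  []-∘ᶜ (T ︔ₗ V) K Z = cong (_︔ V) ([]-∘ᶜ T K Z)
  []-∘ᶜ (V ︔ᵣ T) K Z = cong (V ︔_) ([]-∘ᶜ T K Z)

  -- In the base cases the two holes part; the subscripts list them from left to right,
  -- so in  P ,₂₁ Q  the second hole lies in P.
  data Ctx₂ : Set where
    _,₁₂_ _,₂₁_ _︔₁₂_ _︔₂₁_ : Ctx → Ctx → Ctx₂
    _,ₗ_ _︔ₗ_ : Ctx₂ → Tree → Ctx₂
    _,ᵣ_ _︔ᵣ_ : Tree → Ctx₂ → Ctx₂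

  _[_∣-] : Ctx₂ → Tree → Ctx
  (P ,₁₂ Q) [ Z ∣-] = (P [ Z ]) ,ᵣ Q
  (P ,₂₁ Q) [ Z ∣-] = P ,ₗ (Q [ Z ])
  (P ︔₁₂ Q) [ Z ∣-] = (P [ Z ]) ︔ᵣ Q
  (P ︔₂₁ Q) [ Z ∣-] = P ︔ₗ (Q [ Z ])
  (D ,ₗ V) [ Z ∣-] = (D [ Z ∣-]) ,ₗ V
  (V ,ᵣ D) [ Z ∣-] = V ,ᵣ (D [ Z ∣-])
  (D ︔ₗ V) [ Z ∣-] = (D [ Z ∣-]) ︔ₗ V
  (V ︔ᵣ D) [ Z ∣-] = V ︔ᵣ (D [ Z ∣-])

  _[-∣_] : Ctx₂ → Tree → Ctx
  (P ,₁₂ Q) [-∣ Z ] = P ,ₗ (Q [ Z ])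
  (P ,₂₁ Q) [-∣ Z ] = (P [ Z ]) ,ᵣ Q
  (P ︔₁₂ Q) [-∣ Z ] = P ︔ₗ (Q [ Z ])
  (P ︔₂₁ Q) [-∣ Z ] = (P [ Z ]) ︔ᵣ Q
  (D ,ₗ V) [-∣ Z ] = (D [-∣ Z ]) ,ₗ V
  (V ,ᵣ D) [-∣ Z ] = V ,ᵣ (D [-∣ Z ])
  (D ︔ₗ V) [-∣ Z ] = (D [-∣ Z ]) ︔ₗ V
  (V ︔ᵣ D) [-∣ Z ] = V ︔ᵣ (D [-∣ Z ])

  holes-commute : ∀ D Z W → (D [-∣ W ]) [ Z ] ≡ (D [ Z ∣-]) [ W ]
  holes-commute (_ ,₁₂ _) _ _ = refl
  holes-commute (_ ,₂₁ _) _ _ = refl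
  holes-commute (_ ︔₁₂ _) _ _ = refl
  holes-commute (_ ︔₂₁ _) _ _ = refl
  holes-commute (D ,ₗ V) Z W = cong (_,, V) (holes-commute D Z W)
  holes-commute (V ,ᵣ D) Z W = cong (V ,,_) (holes-commute D Z W)
  holes-commute (D ︔ₗ V) Z W = cong (_︔ V) (holes-commute D Z W)
  holes-commute (V ︔ᵣ D) Z W = cong (V ︔_) (holes-commute D Z W)

  data Position (X : Tree) (Y : Fma) : Ctx → Ctx → Set where
    within : ∀ {T′} K → X ≡ K [ η Y ] → Position X Y T′ (T′ ∘ᶜ K)
    apart  : ∀ D → Position X Y (D [-∣ η Y ]) (D [ X ∣-])

  position : ∀ T′ T → T′ [ X ] ≡ T [ η Y ] → Position X Y T′ T
  position ∙ T e = within T e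
  position (T′ ,ₗ V) (T ,ₗ _) e with ,,-injective e
  ... | e′ , refl with position T′ T e′
  ...   | within K e″ = within K e″
  ...   | apart D = apart (D ,ₗ V)
  position (V ,ᵣ T′) (_ ,ᵣ T) e with ,,-injective e
  ... | refl , e′ with position T′ T e′
  ...   | within K e″ = within K e″
  ...   | apart D = apart (V ,ᵣ D)
  position (T′ ︔ₗ V) (T ︔ₗ _) e with ︔-injective e
  ... | e′ , refl with position T′ T e′
  ...   | within K e″ = within K e″
  ...   | apart D = apart (D ︔ₗ V)
  position (V ︔ᵣ T′) (_ ︔ᵣ T) e with ︔-injective e
  ... | refl , e′ with position T′ T e′
  ...   | within K e″ = within K e″
  ...   | apart D = apart (V ︔ᵣ D)
  position (T′ ,ₗ _) (_ ,ᵣ T) e with ,,-injective e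
  ... | refl , refl = apart (T′ ,₁₂ T)
  position (_ ,ᵣ T′) (T ,ₗ _) e with ,,-injective e
  ... | refl , refl = apart (T ,₂₁ T′)
  position (T′ ︔ₗ _) (_ ︔ᵣ T) e with ︔-injective e
  ... | refl , refl = apart (T′ ︔₁₂ T)
  position (_ ︔ᵣ T′) (T ︔ₗ _) e with ︔-injective e
  ... | refl , refl = apart (T ︔₂₁ T′)

  infix 4 _↝_
  infixr 9 _⨾_

  -- S is explicit: it cannot be inferred through the non-injective _[_].
  _↝_ : Tree → Tree → Set
  X′ ↝ X = ∀ S {C} → S [ X′ ] ⊢ C → S [ X ] ⊢ C

  _⨾_ : X ↝ V → V ↝ W → X ↝ W
  (r ⨾ s) S d = s S (r S d)

  under : ∀ T → X′ ↝ X → T [ X′ ] ↝ T [ X ]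
  under {X′ = X′} {X = X} T r S d =
    cast ([]-∘ᶜ S T X) (r (S ∘ᶜ T) (cast (sym ([]-∘ᶜ S T X′)) d))

  IL↝ : ─ ↝ η I
  IL↝ S = IL {T = S}

  ⊗LL↝ : η A ,, η B ↝ η (A ⊗L B)
  ⊗LL↝ S = ⊗LL {T = S}

  ⊗RL↝ : η A ︔ η B ↝ η (A ⊗R B)
  ⊗RL↝ S = ⊗RL {T = S}

  ⊸LL↝ : W ⊢ A → η B ↝ η (A ⊸L B) ,, W
  ⊸LL↝ w S = ⊸LL {T = S} w

  ⊸RL↝ : W ⊢ A → η B ↝ η (A ⊸R B) ︔ W
  ⊸RL↝ w S = ⊸RL {T = S} w

  assocL↝ : U₀ ,, (U₁ ,, U₂) ↝ (U₀ ,, U₁) ,, U₂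
  assocL↝ S = assocL {T = S}

  assocR↝ : (U₀ ︔ U₁) ︔ U₂ ↝ U₀ ︔ (U₁ ︔ U₂)
  assocR↝ S = assocR {T = S}

  comm↝ : U₀ ,, U₁ ↝ U₁ ︔ U₀
  comm↝ S = comm {T = S}

  comm⁻¹↝ : U₁ ︔ U₀ ↝ U₀ ,, U₁
  comm⁻¹↝ S = comm⁻¹ {T = S}

  unitLL↝ : U ↝ ─ ,, U
  unitLL↝ S = unitLL {T = S}

  unitRL↝ : U ,, ─ ↝ U
  unitRL↝ S = unitRL {T = S}

  unitLR↝ : U ↝ U ︔ ─
  unitLR↝ S = unitLR {T = S}

  unitRR↝ : ─ ︔ U ↝ U
  unitRR↝ S = unitRR {T = S}

  PrincipalCut : Fma → Tree → Set
  PrincipalCut (at _)   U = ⊤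
  PrincipalCut I        U = ─ ↝ U
  PrincipalCut (A ⊗L B) U = η A ,, η B ↝ U
  PrincipalCut (A ⊗R B) U = η A ︔ η B ↝ U
  PrincipalCut (A ⊸L B) U = ∀ {W} → W ⊢ A → η B ↝ U ,, W
  PrincipalCut (A ⊸R B) U = ∀ {W} → W ⊢ A → η B ↝ U ︔ W

  Replaceable : Fma → Tree → Tree → Fma → Set
  Replaceable A U V C = ∀ S → V ≡ S [ η A ] → S [ U ] ⊢ C

  ReplaceableWithin : Fma → Tree → Ctx → Tree → Fma → Set
  ReplaceableWithin A U T X C = ∀ K → X ≡ K [ η A ] → T [ K [ U ] ] ⊢ C

  replace-nested : ∀ T K → Replaceable A U (T [ K [ η A ] ]) C → T [ K [ U ] ] ⊢ C
  replace-nested {A = A} {U = U} T K ih =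
    cast ([]-∘ᶜ T K U) (ih (T ∘ᶜ K) (sym ([]-∘ᶜ T K (η A))))

  replace-apart : ∀ D → X′ ↝ X → Replaceable A U ((D [-∣ η A ]) [ X′ ]) C
                → (D [ X ∣-]) [ U ] ⊢ C
  replace-apart {X′ = X′} {X = X} {A = A} {U = U} D r ih =
    cast (holes-commute D X U)
      (r (D [-∣ U ]) (cast (sym (holes-commute D X′ U))
        (ih (D [ X′ ∣-]) (holes-commute D X′ (η A)))))

  replace-under : ∀ T → X′ ↝ X → Replaceable A U (T [ X′ ]) C
                → ReplaceableWithin A U T X C → Replaceable A U (T [ X ]) C
  replace-under {U = U} T r ih inside S e with position T S e
  ... | within K e′ = cast (sym ([]-∘ᶜ T K U)) (inside K e′)
  ... | apart D = replace-apart D r ih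

  within-IL : PrincipalCut A U → T [ ─ ] ⊢ C → ReplaceableWithin A U T (η I) C
  within-IL {T = T} p g ∙ refl = p T g

  within-⊗LL : PrincipalCut A U → T [ η A₁ ,, η B₁ ] ⊢ C
             → ReplaceableWithin A U T (η (A₁ ⊗L B₁)) C
  within-⊗LL {T = T} p g ∙ refl = p T g

  within-⊗RL : PrincipalCut A U → T [ η A₁ ︔ η B₁ ] ⊢ C
             → ReplaceableWithin A U T (η (A₁ ⊗R B₁)) C
  within-⊗RL {T = T} p g ∙ refl = p T g

  within-⊸LL : PrincipalCut A U → W ⊢ A₁ → T [ η B₁ ] ⊢ C → Replaceable A U W A₁
             → ReplaceableWithin A U T (η (A₁ ⊸L B₁) ,, W) C
  within-⊸LL {T = T} p w g _ (∙ ,ₗ _) refl = p w T g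
  within-⊸LL {T = T} _ _ g ih (_ ,ᵣ K) refl = ⊸LL↝ (ih K refl) T g

  within-⊸RL : PrincipalCut A U → W ⊢ A₁ → T [ η B₁ ] ⊢ C → Replaceable A U W A₁
             → ReplaceableWithin A U T (η (A₁ ⊸R B₁) ︔ W) C
  within-⊸RL {T = T} p w g _ (∙ ︔ₗ _) refl = p w T g
  within-⊸RL {T = T} _ _ g ih (_ ︔ᵣ K) refl = ⊸RL↝ (ih K refl) T g

  within-assocL : Replaceable A U (T [ U₀ ,, (U₁ ,, U₂) ]) C
                → ReplaceableWithin A U T ((U₀ ,, U₁) ,, U₂) C
  within-assocL {T = T} ih ((K ,ₗ V₁) ,ₗ V₂) refl =
    assocL↝ T (replace-nested T (K ,ₗ (V₁ ,, V₂)) ih)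
  within-assocL {T = T} ih ((V₀ ,ᵣ K) ,ₗ V₂) refl =
    assocL↝ T (replace-nested T (V₀ ,ᵣ (K ,ₗ V₂)) ih)
  within-assocL {T = T} {U₀ = U₀} {U₁ = U₁} ih (_ ,ᵣ K) refl =
    assocL↝ T (replace-nested T (U₀ ,ᵣ (U₁ ,ᵣ K)) ih)

  within-assocR : Replaceable A U (T [ (U₀ ︔ U₁) ︔ U₂ ]) C
                → ReplaceableWithin A U T (U₀ ︔ (U₁ ︔ U₂)) C
  within-assocR {T = T} {U₁ = U₁} {U₂ = U₂} ih (K ︔ₗ _) refl =
    assocR↝ T (replace-nested T ((K ︔ₗ U₁) ︔ₗ U₂) ih)
  within-assocR {T = T} {U₀ = U₀} ih (_ ︔ᵣ (K ︔ₗ V₂)) refl =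
    assocR↝ T (replace-nested T ((U₀ ︔ᵣ K) ︔ₗ V₂) ih)
  within-assocR {T = T} {U₀ = U₀} ih (_ ︔ᵣ (V₁ ︔ᵣ K)) refl =
    assocR↝ T (replace-nested T ((U₀ ︔ V₁) ︔ᵣ K) ih)

  within-comm : Replaceable A U (T [ U₀ ,, U₁ ]) C → ReplaceableWithin A U T (U₁ ︔ U₀) C
  within-comm {T = T} {U₀ = U₀} ih (K ︔ₗ _) refl = comm↝ T (replace-nested T (U₀ ,ᵣ K) ih)
  within-comm {T = T} {U₁ = U₁} ih (_ ︔ᵣ K) refl = comm↝ T (replace-nested T (K ,ₗ U₁) ih)

  within-comm⁻¹ : Replaceable A U (T [ U₁ ︔ U₀ ]) C → ReplaceableWithin A U T (U₀ ,, U₁) C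
  within-comm⁻¹ {T = T} {U₁ = U₁} ih (K ,ₗ _) refl = comm⁻¹↝ T (replace-nested T (U₁ ︔ᵣ K) ih)
  within-comm⁻¹ {T = T} {U₀ = U₀} ih (_ ,ᵣ K) refl = comm⁻¹↝ T (replace-nested T (K ︔ₗ U₀) ih)

  within-unitLL : Replaceable A U (T [ U₀ ]) C → ReplaceableWithin A U T (─ ,, U₀) C
  within-unitLL {T = T} ih (_ ,ᵣ K) refl = unitLL↝ T (replace-nested T K ih)
  within-unitLL ih (K ,ₗ _) e with () ← ─-has-no-hole K (proj₁ (,,-injective e))

  within-unitLR : Replaceable A U (T [ U₀ ]) C → ReplaceableWithin A U T (U₀ ︔ ─) C
  within-unitLR {T = T} ih (K ︔ₗ _) refl = unitLR↝ T (replace-nested T K ih)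
  within-unitLR ih (_ ︔ᵣ K) e with () ← ─-has-no-hole K (proj₂ (︔-injective e))

  within-unitRL : Replaceable A U (T [ U₀ ,, ─ ]) C → ReplaceableWithin A U T U₀ C
  within-unitRL {T = T} ih K refl = unitRL↝ T (replace-nested T (K ,ₗ ─) ih)

  within-unitRR : Replaceable A U (T [ ─ ︔ U₀ ]) C → ReplaceableWithin A U T U₀ C
  within-unitRR {T = T} ih K refl = unitRR↝ T (replace-nested T (─ ︔ᵣ K) ih)

  cut-right : U ⊢ A → PrincipalCut A U → V ⊢ C → Replaceable A U V C
  cut-right f p ax ∙ refl = f
  cut-right f p IR S e with () ← ─-has-no-hole S e
  cut-right f p (IL {T = T} g) = replace-under T IL↝ (cut-right f p g) (within-IL p g)
  cut-right f p (⊗LL {T = T} g) = replace-under T ⊗LL↝ (cut-right f p g) (within-⊗LL p g)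
  cut-right f p (⊗RL {T = T} g) = replace-under T ⊗RL↝ (cut-right f p g) (within-⊗RL p g)
  cut-right f p (⊸LL {T = T} w g) =
    replace-under T (⊸LL↝ w) (cut-right f p g) (within-⊸LL p w g (cut-right f p w))
  cut-right f p (⊸RL {T = T} w g) =
    replace-under T (⊸RL↝ w) (cut-right f p g) (within-⊸RL p w g (cut-right f p w))
  cut-right f p (assocL {T = T} g) = replace-under T assocL↝ ih (within-assocL ih)
    where ih = cut-right f p g
  cut-right f p (assocR {T = T} g) = replace-under T assocR↝ ih (within-assocR ih)
    where ih = cut-right f p g
  cut-right f p (comm {T = T} g) = replace-under T comm↝ ih (within-comm ih)
    where ih = cut-right f p g
  cut-right f p (comm⁻¹ {T = T} g) = replace-under T comm⁻¹↝ ih (within-comm⁻¹ ih)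
    where ih = cut-right f p g
  cut-right f p (unitLL {T = T} g) = replace-under T unitLL↝ ih (within-unitLL ih)
    where ih = cut-right f p g
  cut-right f p (unitRL {T = T} g) = replace-under T unitRL↝ ih (within-unitRL ih)
    where ih = cut-right f p g
  cut-right f p (unitLR {T = T} g) = replace-under T unitLR↝ ih (within-unitLR ih)
    where ih = cut-right f p g
  cut-right f p (unitRR {T = T} g) = replace-under T unitRR↝ ih (within-unitRR ih)
    where ih = cut-right f p g
  cut-right f p (⊗LR g₁ g₂) (T ,ₗ _) refl = ⊗LR (cut-right f p g₁ T refl) g₂
  cut-right f p (⊗LR g₁ g₂) (_ ,ᵣ T) refl = ⊗LR g₁ (cut-right f p g₂ T refl)
  cut-right f p (⊗RR g₁ g₂) (T ︔ₗ _) refl = ⊗RR (cut-right f p g₁ T refl) g₂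
  cut-right f p (⊗RR g₁ g₂) (_ ︔ᵣ T) refl = ⊗RR g₁ (cut-right f p g₂ T refl)
  cut-right f p (⊸LR {A = A₁} g) T refl = ⊸LR (cut-right f p g (T ,ₗ η A₁) refl)
  cut-right f p (⊸RR {A = A₁} g) T refl = ⊸RR (cut-right f p g (T ︔ₗ η A₁) refl)

  cut-principal : U ⊢ A → PrincipalCut A U → η A ↝ U
  cut-principal f p S g = cut-right f p g S refl

  cut : U ⊢ A → η A ↝ U
  cut ax S g = g
  cut IR = cut-principal IR (λ S g → g)
  cut (⊗LR {T = U₁} {B = B} f₁ f₂) =
    cut-principal (⊗LR f₁ f₂) (under (∙ ,ₗ η B) (cut f₁) ⨾ under (U₁ ,ᵣ ∙) (cut f₂))
  cut (⊗RR {T = U₁} {B = B} f₁ f₂) =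
    cut-principal (⊗RR f₁ f₂) (under (∙ ︔ₗ η B) (cut f₁) ⨾ under (U₁ ︔ᵣ ∙) (cut f₂))
  cut (⊸LR {T = U₀} f) = cut-principal (⊸LR f) (λ w → cut (cut w (U₀ ,ᵣ ∙) f))
  cut (⊸RR {T = U₀} f) = cut-principal (⊸RR f) (λ w → cut (cut w (U₀ ︔ᵣ ∙) f))
  cut (IL {T = T} f) = cut f ⨾ under T IL↝
  cut (⊗LL {T = T} f) = cut f ⨾ under T ⊗LL↝
  cut (⊗RL {T = T} f) = cut f ⨾ under T ⊗RL↝
  cut (⊸LL {T = T} w f) = cut f ⨾ under T (⊸LL↝ w)
  cut (⊸RL {T = T} w f) = cut f ⨾ under T (⊸RL↝ w)
  cut (assocL {T = T} f) = cut f ⨾ under T assocL↝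
  cut (assocR {T = T} f) = cut f ⨾ under T assocR↝
  cut (comm {T = T} f) = cut f ⨾ under T comm↝
  cut (comm⁻¹ {T = T} f) = cut f ⨾ under T comm⁻¹↝
  cut (unitLL {T = T} f) = cut f ⨾ under T unitLL↝
  cut (unitRL {T = T} f) = cut f ⨾ under T unitRL↝
  cut (unitLR {T = T} f) = cut f ⨾ under T unitLR↝
  cut (unitRR {T = T} f) = cut f ⨾ under T unitRR↝

mainTheorem5 : (At : Set) → let open SkMBiCT At in
                 ∀ {U : Tree} {T : Ctx} {A C : Fma} →
                   U ⊢ A → T [ η A ] ⊢ C → T [ U ] ⊢ C
mainTheorem5 At {T = T} f = CutAdmissibility.cut At f T
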